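{- Let $a_n$ be the number of inversion sequences of size $n$ avoiding both patterns $201$ and $210$. Then $$\sum_{n\geqslant 0} a_n t^n = \frac{2-t-t\sqrt{1-8t}}{4t^2 - 4t + 2}.$$
   Context: An inversion sequence of size $n$ is a sequence $\sigma=(\sigma_1,\dots,\sigma_n)$ of integers with $\sigma_i\in\{0,\dots,i-1\}$ for all $i$ (the empty sequence is the unique one of size $0$). A sequence contains the pattern $201$ (resp. $210$) if it has entries at positions $a<b<c$ with $\sigma_b<\sigma_c<\sigma_a$ (resp. $\sigma_c<\sigma_b<\sigma_a$); otherwise it avoids it. The identity is one of formal power series in $t$. -}

module Defs where

open import Data.Nat as ℕ using (ℕ; zero; suc; _∸_; _<ᵇ_)
open import Data.Bool using (Bool; true; false; _∧_; _∨_; not)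
open import Data.Bool.ListAction using (any)
open import Data.List using (List; []; _∷_; _++_; [_]; map; concatMap; upTo; filterᵇ; length; foldr)
open import Data.Integer using (+_)
open import Data.Rational as ℚ using (ℚ; 0ℚ; 1ℚ; _/_)

-- entry at position i (0-based) of a list; default 0 (only used for valid i)
at : List ℕ → ℕ → ℕ
at []       _       = 0
at (x ∷ xs) zero    = x
at (x ∷ xs) (suc i) = at xs i

-- All inversion sequences of size n, as lists (σ₁,…,σₙ) with σᵢ ∈ {0,…,i-1}:
-- a size-(n+1) sequence is a size-n sequence followed by σₙ₊₁ ∈ {0,…,n}.
invSeqs : ℕ → List (List ℕ)
invSeqs zero    = [] ∷ []
invSeqs (suc n) = concatMap (λ s → map (λ k → s ++ [ k ]) (upTo (suc n))) (invSeqs n)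

hasTriple : (ℕ → ℕ → ℕ → Bool) → List ℕ → Bool
hasTriple P s =
  any (λ c → any (λ b → any (λ a → P (at s a) (at s b) (at s c)) (upTo b)) (upTo c))
      (upTo (length s))

contains201 : List ℕ → Bool
contains201 = hasTriple (λ x y z → (y <ᵇ z) ∧ (z <ᵇ x))

contains210 : List ℕ → Bool
contains210 = hasTriple (λ x y z → (z <ᵇ y) ∧ (y <ᵇ x))

a : ℕ → ℕ
a n = length (filterᵇ (λ s → not (contains201 s ∨ contains210 s)) (invSeqs n))

PS : Set
PS = ℕ → ℚ

sumℚ : List ℚ → ℚ
sumℚ = foldr ℚ._+_ 0ℚ

_⊕_ : PS → PS → PS
(f ⊕ g) n = f n ℚ.+ g n

_⊖_ : PS → PS → PS
(f ⊖ g) n = f n ℚ.- g n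

_⊛_ : PS → PS → PS
(f ⊛ g) n = sumℚ (map (λ k → f k ℚ.* g (n ∸ k)) (upTo (suc n)))

const : ℚ → PS
const q zero    = q
const q (suc _) = 0ℚ

tPS : PS
tPS (suc zero) = 1ℚ
tPS _          = 0ℚ

q : ℕ → ℚ
q n = + n / 1

A : PS
A n = q (a n)

-- Appending k to an inversion sequence s creates a 201 or a 210 exactly when some pair of
-- positions a < b with s_a > s_b has k < s_a and k ≠ s_b.  So the ways of extending an avoider
-- are governed by a small state: its maximum m and, once some entry has fallen below an earlier
-- one, a threshold M and a value v such that the admissible next entries are the k ≥ M and k = v.
--
-- Let G be the power series with 2tG² − G + 1 = 0, so that √(1 − 8t) = 1 − 4tG, and κ = 1 + G².
-- There is a weight on states, polynomial in t, G, G^(n − m) and m − M, which is harmonic on the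
-- generating tree: the weight of an avoider of size n is κ plus t times the total weight of its
-- children.  Summing over the avoiders of size n + 1 gives W(n+1) = a(n+1) κ + t W(n+2), which
-- unrolls to κ Σ a(n+1) tⁿ = W(1) = 2G².  Eliminating G with its quadratic equation yields
-- (4t² − 4t + 2) A = 2 − t − t √(1 − 8t).

{-# OPTIONS --safe #-}
module Submission where

open import Defs
open import Data.Nat using (ℕ)
open import Relation.Binary.PropositionalEquality using (_≡_)

import Algebra.Properties.CommutativeSemigroup as CommutativeSemigroupProperties
import Algebra.Properties.Group as GroupProperties
open import Algebra.Bundles using (CommutativeMonoid; CommutativeRing; RawRing; Semiring)
open import Algebra.Structures using (IsCommutativeRing)
import Algebra.Solver.Ring
import Algebra.Solver.Ring.AlmostCommutativeRing as ACR
open import Data.Bool using (Bool; true; false; _∧_; _∨_; not; if_then_else_)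
import Data.Bool.Properties as Bool
open import Data.Bool.ListAction using (any)
open import Data.Integer as ℤ using (+_)
import Data.Integer.Properties as ℤ
import Data.Nat.Coprimality as Coprimality
open import Data.List
  using (List; []; _∷_; _++_; [_]; _∷ʳ_; map; concatMap; upTo; applyUpTo; filterᵇ; length; foldr; foldl)
import Data.List.Properties as List
open import Data.List.Relation.Unary.All as All using (All; []; _∷_)
import Data.List.Relation.Unary.All.Properties as All
open import Data.List.Reverse using (Reverse; []; _∶_∶ʳ_; reverseView)
open import Data.Maybe using (Maybe; just; nothing)
open import Data.Nat as ℕ
  using (zero; suc; _∸_; _⊔_; _<_; _≤_; _≤ᵇ_; _<ᵇ_; _≡ᵇ_; _≤?_; _<?_; _≟_; z≤n; s≤s)
import Data.Nat.Properties as ℕ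
open import Data.Product using (_×_; _,_)
open import Data.Rational as ℚ using (ℚ; 0ℚ; 1ℚ)
import Data.Rational.Properties as ℚ
open import Data.Sum using (inj₁; inj₂)
open import Data.Unit using (⊤; tt)
open import Function using (_∘_)
open import Level using (0ℓ)
open import Relation.Binary.Definitions using (tri<; tri≈; tri>)
open import Relation.Binary.PropositionalEquality
  using (refl; sym; trans; cong; cong₂; subst; _≢_; _≗_; module ≡-Reasoning)
import Relation.Binary.Reasoning.Setoid
open import Relation.Nullary using (yes; no)
open import Relation.Nullary.Decidable using (dec-true; dec-false)
open import Tactic.RingSolver using (solve-∀)
open import Tactic.RingSolver.Core.AlmostCommutativeRing using (AlmostCommutativeRing; fromCommutativeRing)

-- Finite sums

module Sums {c ℓ} (R : Semiring c ℓ) where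

  open Semiring R renaming (refl to ≈-refl; sym to ≈-sym; trans to ≈-trans)

  ∑ : {A : Set} → List A → (A → Carrier) → Carrier
  ∑ []       F = 0#
  ∑ (x ∷ xs) F = F x + ∑ xs F

  ∑< : ℕ → (ℕ → Carrier) → Carrier
  ∑< zero    F = 0#
  ∑< (suc n) F = F 0 + ∑< n (F ∘ suc)

  syntax ∑ L (λ x → F) = ∑[ x ∈ L ] F
  syntax ∑< n (λ i → F) = ∑[ i < n ] F

  ∑-cong : ∀ {A : Set} {L : List A} {F G} → All (λ x → F x ≈ G x) L → ∑ L F ≈ ∑ L G
  ∑-cong []       = ≈-refl
  ∑-cong (p ∷ ps) = +-cong p (∑-cong ps)

  ∑<-cong : ∀ n {F G} → (∀ i → i < n → F i ≈ G i) → ∑< n F ≈ ∑< n G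
  ∑<-cong zero    p = ≈-refl
  ∑<-cong (suc n) p = +-cong (p 0 (s≤s z≤n)) (∑<-cong n (λ i i<n → p (suc i) (s≤s i<n)))

  ∑-++ : ∀ {A : Set} (xs ys : List A) F → ∑ (xs ++ ys) F ≈ ∑ xs F + ∑ ys F
  ∑-++ []       ys F = ≈-sym (+-identityˡ _)
  ∑-++ (x ∷ xs) ys F = ≈-trans (+-cong ≈-refl (∑-++ xs ys F)) (≈-sym (+-assoc _ _ _))

  ∑-concatMap : ∀ {A B : Set} (g : A → List B) L F → ∑ (concatMap g L) F ≈ ∑[ x ∈ L ] ∑ (g x) F
  ∑-concatMap g []       F = ≈-refl
  ∑-concatMap g (x ∷ L) F = ≈-trans (∑-++ (g x) (concatMap g L) F) (+-cong ≈-refl (∑-concatMap g L F))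

  ∑-applyUpTo : ∀ {A : Set} (g : ℕ → A) n F → ∑ (applyUpTo g n) F ≈ ∑< n (F ∘ g)
  ∑-applyUpTo g zero    F = ≈-refl
  ∑-applyUpTo g (suc n) F = +-cong ≈-refl (∑-applyUpTo (g ∘ suc) n F)

  ∑-filterᵇ : ∀ {A : Set} (p : A → Bool) L F → ∑ (filterᵇ p L) F ≈ ∑[ x ∈ L ] (if p x then F x else 0#)
  ∑-filterᵇ p []      F = ≈-refl
  ∑-filterᵇ p (x ∷ L) F with p x
  ... | true  = +-cong ≈-refl (∑-filterᵇ p L F)
  ... | false = ≈-trans (∑-filterᵇ p L F) (≈-sym (+-identityˡ _))

  fromℕ : ℕ → Carrier
  fromℕ zero    = 0#
  fromℕ (suc n) = 1# + fromℕ n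

  fromℕ-suc-* : ∀ n r → r + fromℕ n * r ≈ fromℕ (suc n) * r
  fromℕ-suc-* n r = ≈-trans (+-cong (≈-sym (*-identityˡ r)) ≈-refl) (≈-sym (distribʳ r 1# (fromℕ n)))

  ∑-const : ∀ {A : Set} (L : List A) r → ∑[ x ∈ L ] r ≈ fromℕ (length L) * r
  ∑-const []      r = ≈-sym (zeroˡ r)
  ∑-const (x ∷ L) r = ≈-trans (+-cong ≈-refl (∑-const L r)) (fromℕ-suc-* (length L) r)

  ∑<-const : ∀ n r → ∑[ i < n ] r ≈ fromℕ n * r
  ∑<-const zero    r = ≈-sym (zeroˡ r)
  ∑<-const (suc n) r = ≈-trans (+-cong ≈-refl (∑<-const n r)) (fromℕ-suc-* n r)

  ∑-+ : ∀ {A : Set} (L : List A) F G → ∑[ x ∈ L ] (F x + G x) ≈ ∑ L F + ∑ L G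
  ∑-+ []      F G = ≈-sym (+-identityˡ 0#)
  ∑-+ (x ∷ L) F G = ≈-trans (+-cong ≈-refl (∑-+ L F G)) (interchange (F x) (G x) (∑ L F) (∑ L G))
    where open CommutativeSemigroupProperties +-commutativeSemigroup using (interchange)

  ∑-*ˡ : ∀ {A : Set} (L : List A) r F → ∑[ x ∈ L ] (r * F x) ≈ r * ∑ L F
  ∑-*ˡ []      r F = ≈-sym (zeroʳ r)
  ∑-*ˡ (x ∷ L) r F = ≈-trans (+-cong ≈-refl (∑-*ˡ L r F)) (≈-sym (distribˡ r (F x) (∑ L F)))

  ∑<-split : ∀ m n F → ∑< (m ℕ.+ n) F ≈ ∑< m F + ∑[ i < n ] F (m ℕ.+ i)
  ∑<-split zero    n F = ≈-sym (+-identityˡ _)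
  ∑<-split (suc m) n F = ≈-trans (+-cong ≈-refl (∑<-split m n (F ∘ suc))) (≈-sym (+-assoc _ _ _))

  ∑<-zero : ∀ n → ∑[ i < n ] 0# ≈ 0#
  ∑<-zero zero    = ≈-refl
  ∑<-zero (suc n) = ≈-trans (+-identityˡ _) (∑<-zero n)

  ∑<-if : ∀ n b F → ∑[ i < n ] (if b then F i else 0#) ≈ (if b then ∑< n F else 0#)
  ∑<-if n true  F = ≈-refl
  ∑<-if n false F = ∑<-zero n

  ∑<-indicator : ∀ {n v} r → v < n → ∑[ k < n ] (if k ≡ᵇ v then r else 0#) ≈ r
  ∑<-indicator {suc n} {zero}  r _         = ≈-trans (+-cong ≈-refl (∑<-zero n)) (+-identityʳ r)
  ∑<-indicator {suc n} {suc v} r (s≤s v<n) = ≈-trans (+-identityˡ _) (∑<-indicator r v<n)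

-- Avoiding 201 and 210

≤ᵇ-true : ∀ {m n} → m ≤ n → (m ≤ᵇ n) ≡ true
≤ᵇ-true = dec-true (_ ≤? _)

≤ᵇ-false : ∀ {m n} → n < m → (m ≤ᵇ n) ≡ false
≤ᵇ-false = dec-false (_ ≤? _) ∘ ℕ.<⇒≱

<ᵇ-true : ∀ {m n} → m < n → (m <ᵇ n) ≡ true
<ᵇ-true = dec-true (_ <? _)

<ᵇ-false : ∀ {m n} → n ≤ m → (m <ᵇ n) ≡ false
<ᵇ-false = dec-false (_ <? _) ∘ ℕ.≤⇒≯

≡ᵇ-true : ∀ {m} → (m ≡ᵇ m) ≡ true
≡ᵇ-true {m} = dec-true (m ≟ m) refl

≡ᵇ-false : ∀ {m n} → m ≢ n → (m ≡ᵇ n) ≡ false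
≡ᵇ-false = dec-false (_ ≟ _)

anyBelow : ℕ → (ℕ → Bool) → Bool
anyBelow zero    p = false
anyBelow (suc n) p = anyBelow n p ∨ p n

any-++ : ∀ {A : Set} (p : A → Bool) xs ys → any p (xs ++ ys) ≡ any p xs ∨ any p ys
any-++ p []       ys = refl
any-++ p (x ∷ xs) ys = trans (cong (p x ∨_) (any-++ p xs ys)) (sym (Bool.∨-assoc (p x) _ _))

any-upTo : ∀ n p → any p (upTo n) ≡ anyBelow n p
any-upTo zero    p = refl
any-upTo (suc n) p = begin
  any p (upTo (suc n))            ≡⟨ cong (any p) (sym (List.upTo-∷ʳ n)) ⟩
  any p (upTo n ∷ʳ n)             ≡⟨ any-++ p (upTo n) [ n ] ⟩
  any p (upTo n) ∨ (p n ∨ false)  ≡⟨ cong₂ _∨_ (any-upTo n p) (Bool.∨-identityʳ (p n)) ⟩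
  anyBelow n p ∨ p n              ∎
  where open ≡-Reasoning

anyBelow-cong : ∀ n {p q} → (∀ i → i < n → p i ≡ q i) → anyBelow n p ≡ anyBelow n q
anyBelow-cong zero    _   = refl
anyBelow-cong (suc n) p≡q =
  cong₂ _∨_ (anyBelow-cong n (λ i i<n → p≡q i (ℕ.m<n⇒m<1+n i<n))) (p≡q n ℕ.≤-refl)

anyBelow-∧ : ∀ n b p → anyBelow n (λ i → b ∧ p i) ≡ b ∧ anyBelow n p
anyBelow-∧ zero    b p = sym (Bool.∧-zeroʳ b)
anyBelow-∧ (suc n) b p = trans (cong (_∨ (b ∧ p n)) (anyBelow-∧ n b p)) (sym (Bool.∧-distribˡ-∨ b _ _))

anyBelow-suc : ∀ n p → anyBelow (suc n) p ≡ p 0 ∨ anyBelow n (p ∘ suc)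
anyBelow-suc zero    p = Bool.∨-comm false (p 0)
anyBelow-suc (suc n) p = trans (cong (_∨ p (suc n)) (anyBelow-suc n p)) (Bool.∨-assoc (p 0) _ _)

Pattern : Set
Pattern = ℕ → ℕ → ℕ → Bool

closesBelow : Pattern → (ℕ → ℕ) → ℕ → ℕ → Bool
closesBelow P e n z = anyBelow n (λ b → anyBelow b (λ a → P (e a) (e b) z))

triplesBelow : Pattern → (ℕ → ℕ) → ℕ → Bool
triplesBelow P e n = anyBelow n (λ c → closesBelow P e c (e c))

closesBelow-cong : ∀ P n {e e′} z → (∀ i → i < n → e i ≡ e′ i) →
                   closesBelow P e n z ≡ closesBelow P e′ n z
closesBelow-cong P n z e≡e′ = anyBelow-cong n λ b b<n → anyBelow-cong b λ a a<b →
  cong₂ (λ x y → P x y z) (e≡e′ a (ℕ.<-trans a<b b<n)) (e≡e′ b b<n)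

triplesBelow-cong : ∀ P n {e e′} → (∀ i → i < n → e i ≡ e′ i) →
                    triplesBelow P e n ≡ triplesBelow P e′ n
triplesBelow-cong P n e≡e′ = anyBelow-cong n λ c c<n →
  trans (cong (closesBelow P _ c) (e≡e′ c c<n))
        (closesBelow-cong P c _ (λ i i<c → e≡e′ i (ℕ.<-trans i<c c<n)))

hasTriple-triplesBelow : ∀ P s → hasTriple P s ≡ triplesBelow P (at s) (length s)
hasTriple-triplesBelow P s = trans (any-upTo (length s) _) (anyBelow-cong (length s) λ c _ →
  trans (any-upTo c _) (anyBelow-cong c λ b _ → any-upTo b _))

length-∷ʳ : ∀ (s : List ℕ) k → length (s ∷ʳ k) ≡ suc (length s)
length-∷ʳ s k = trans (List.length-++ s) (ℕ.+-comm (length s) 1)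

at-∷ʳ : ∀ s k {i} → i < length s → at (s ∷ʳ k) i ≡ at s i
at-∷ʳ (x ∷ s) k {zero}  _         = refl
at-∷ʳ (x ∷ s) k {suc i} (s≤s i<n) = at-∷ʳ s k i<n

at-∷ʳ-length : ∀ s k → at (s ∷ʳ k) (length s) ≡ k
at-∷ʳ-length []      k = refl
at-∷ʳ-length (x ∷ s) k = at-∷ʳ-length s k

closes : Pattern → List ℕ → ℕ → Bool
closes P s = closesBelow P (at s) (length s)

hasTriple-∷ʳ : ∀ P s k → hasTriple P (s ∷ʳ k) ≡ hasTriple P s ∨ closes P s k
hasTriple-∷ʳ P s k = begin
  hasTriple P (s ∷ʳ k)
    ≡⟨ hasTriple-triplesBelow P (s ∷ʳ k) ⟩
  triplesBelow P (at (s ∷ʳ k)) (length (s ∷ʳ k))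
    ≡⟨ cong (triplesBelow P (at (s ∷ʳ k))) (length-∷ʳ s k) ⟩
  triplesBelow P (at (s ∷ʳ k)) (length s) ∨ closesBelow P (at (s ∷ʳ k)) (length s) (at (s ∷ʳ k) (length s))
    ≡⟨ cong₂ _∨_ (triplesBelow-cong P (length s) (λ _ → at-∷ʳ s k))
                 (trans (cong (closesBelow P _ (length s)) (at-∷ʳ-length s k))
                        (closesBelow-cong P (length s) k (λ _ → at-∷ʳ s k))) ⟩
  triplesBelow P (at s) (length s) ∨ closes P s k
    ≡⟨ cong (_∨ closes P s k) (sym (hasTriple-triplesBelow P s)) ⟩
  hasTriple P s ∨ closes P s k ∎
  where open ≡-Reasoning

closes-∷ʳ : ∀ P s k₀ k →
            closes P (s ∷ʳ k₀) k ≡ closes P s k ∨ anyBelow (length s) (λ a → P (at s a) k₀ k)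
closes-∷ʳ P s k₀ k = begin
  closesBelow P (at (s ∷ʳ k₀)) (length (s ∷ʳ k₀)) k
    ≡⟨ cong (λ n → closesBelow P (at (s ∷ʳ k₀)) n k) (length-∷ʳ s k₀) ⟩
  closesBelow P (at (s ∷ʳ k₀)) (length s) k
    ∨ anyBelow (length s) (λ a → P (at (s ∷ʳ k₀) a) (at (s ∷ʳ k₀) (length s)) k)
    ≡⟨ cong₂ _∨_ (closesBelow-cong P (length s) k (λ _ → at-∷ʳ s k₀))
                 (anyBelow-cong (length s) λ a a<n →
                    cong₂ (λ x y → P x y k) (at-∷ʳ s k₀ a<n) (at-∷ʳ-length s k₀)) ⟩
  closes P s k ∨ anyBelow (length s) (λ a → P (at s a) k₀ k) ∎
  where open ≡-Reasoning

maximum : List ℕ → ℕ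
maximum = foldr _⊔_ 0

maximum-∷ʳ : ∀ s k → maximum (s ∷ʳ k) ≡ maximum s ⊔ k
maximum-∷ʳ []      k = ℕ.⊔-identityʳ k
maximum-∷ʳ (x ∷ s) k = trans (cong (x ⊔_) (maximum-∷ʳ s k)) (sym (ℕ.⊔-assoc x (maximum s) k))

<ᵇ-⊔ : ∀ x y z → (x <ᵇ y ⊔ z) ≡ (x <ᵇ y) ∨ (x <ᵇ z)
<ᵇ-⊔ x y z with ℕ.≤-total y z | x <? y
... | inj₁ y≤z | yes x<y
  rewrite ℕ.m≤n⇒m⊔n≡n y≤z | <ᵇ-true x<y | <ᵇ-true (ℕ.<-≤-trans x<y y≤z) = refl
... | inj₁ y≤z | no x≮y  rewrite ℕ.m≤n⇒m⊔n≡n y≤z | <ᵇ-false (ℕ.≮⇒≥ x≮y) = refl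
... | inj₂ z≤y | _ with x <? z
...   | yes x<z rewrite ℕ.m≥n⇒m⊔n≡m z≤y | <ᵇ-true x<z | <ᵇ-true (ℕ.<-≤-trans x<z z≤y) = refl
...   | no x≮z  rewrite ℕ.m≥n⇒m⊔n≡m z≤y | <ᵇ-false (ℕ.≮⇒≥ x≮z) = sym (Bool.∨-identityʳ _)

anyBelow-<-at : ∀ x s → anyBelow (length s) (λ a → x <ᵇ at s a) ≡ (x <ᵇ maximum s)
anyBelow-<-at x []      = refl
anyBelow-<-at x (y ∷ s) = begin
  anyBelow (suc (length s)) (λ a → x <ᵇ at (y ∷ s) a) ≡⟨ anyBelow-suc (length s) _ ⟩
  (x <ᵇ y) ∨ anyBelow (length s) (λ a → x <ᵇ at s a) ≡⟨ cong ((x <ᵇ y) ∨_) (anyBelow-<-at x s) ⟩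
  (x <ᵇ y) ∨ (x <ᵇ maximum s)                        ≡⟨ sym (<ᵇ-⊔ x y (maximum s)) ⟩
  (x <ᵇ y ⊔ maximum s)                               ∎
  where open ≡-Reasoning

is201 is210 : Pattern
is201 x y z = (y <ᵇ z) ∧ (z <ᵇ x)
is210 x y z = (z <ᵇ y) ∧ (y <ᵇ x)

avoids : List ℕ → Bool
avoids s = not (contains201 s ∨ contains210 s)

forbids : List ℕ → ℕ → Bool
forbids s k = closes is201 s k ∨ closes is210 s k

newlyForbidden : ℕ → ℕ → ℕ → Bool
newlyForbidden m k₀ k = ((k₀ <ᵇ k) ∧ (k <ᵇ m)) ∨ ((k <ᵇ k₀) ∧ (k₀ <ᵇ m))

open CommutativeSemigroupProperties (CommutativeMonoid.commutativeSemigroup Bool.∨-commutativeMonoid)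
  using () renaming (interchange to ∨-interchange)

not-∨ : ∀ x y → not (x ∨ y) ≡ not x ∧ not y
not-∨ true  y = refl
not-∨ false y = refl

avoids-∷ʳ : ∀ s k → avoids (s ∷ʳ k) ≡ avoids s ∧ not (forbids s k)
avoids-∷ʳ s k = begin
  not (contains201 (s ∷ʳ k) ∨ contains210 (s ∷ʳ k))
    ≡⟨ cong not (cong₂ _∨_ (hasTriple-∷ʳ is201 s k) (hasTriple-∷ʳ is210 s k)) ⟩
  not ((contains201 s ∨ closes is201 s k) ∨ (contains210 s ∨ closes is210 s k))
    ≡⟨ cong not (∨-interchange (contains201 s) (closes is201 s k) (contains210 s) (closes is210 s k)) ⟩
  not ((contains201 s ∨ contains210 s) ∨ forbids s k)
    ≡⟨ not-∨ (contains201 s ∨ contains210 s) (forbids s k) ⟩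
  avoids s ∧ not (forbids s k) ∎
  where open ≡-Reasoning

forbids-∷ʳ : ∀ s k₀ k → forbids (s ∷ʳ k₀) k ≡ forbids s k ∨ newlyForbidden (maximum s) k₀ k
forbids-∷ʳ s k₀ k = begin
  closes is201 (s ∷ʳ k₀) k ∨ closes is210 (s ∷ʳ k₀) k
    ≡⟨ cong₂ _∨_ (closes-∷ʳ is201 s k₀ k) (closes-∷ʳ is210 s k₀ k) ⟩
  (closes is201 s k ∨ new201) ∨ (closes is210 s k ∨ new210)
    ≡⟨ ∨-interchange (closes is201 s k) new201 (closes is210 s k) new210 ⟩
  forbids s k ∨ (new201 ∨ new210)
    ≡⟨ cong (forbids s k ∨_) (cong₂ _∨_ (exceeding (k₀ <ᵇ k) k) (exceeding (k <ᵇ k₀) k₀)) ⟩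
  forbids s k ∨ newlyForbidden (maximum s) k₀ k ∎
  where
  open ≡-Reasoning
  new201 new210 : Bool
  new201 = anyBelow (length s) (λ a → is201 (at s a) k₀ k)
  new210 = anyBelow (length s) (λ a → is210 (at s a) k₀ k)
  exceeding : ∀ b x → anyBelow (length s) (λ a → b ∧ (x <ᵇ at s a)) ≡ b ∧ (x <ᵇ maximum s)
  exceeding b x = trans (anyBelow-∧ (length s) b _) (cong (b ∧_) (anyBelow-<-at x s))

-- rising m: the sequence is weakly increasing with maximum m.
-- fallen m M v: the sequence has maximum m, and exactly the entries k ≥ M and k = v may follow.
data State : Set where
  rising : ℕ → State
  fallen : ℕ → ℕ → ℕ → State

top : State → ℕ
top (rising m)     = m
top (fallen m _ _) = m

allowed : State → ℕ → Bool
allowed (rising _)     k = true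
allowed (fallen _ M v) k = (M ≤ᵇ k) ∨ (k ≡ᵇ v)

raise : State → ℕ → State
raise (rising _)     k = rising k
raise (fallen _ M v) k = fallen k M v

step : State → ℕ → State
step σ k = if top σ ≤ᵇ k then raise σ k else fallen (top σ) (top σ) k

stateOf : List ℕ → State
stateOf = foldl step (rising 0)

Valid : State → Set
Valid (rising _)     = ⊤
Valid (fallen m M v) = v < M × M ≤ m

step-≥ : ∀ σ {k} → top σ ≤ k → step σ k ≡ raise σ k
step-≥ σ m≤k rewrite ≤ᵇ-true m≤k = refl

step-< : ∀ σ {k} → k < top σ → step σ k ≡ fallen (top σ) (top σ) k
step-< σ k<m rewrite ≤ᵇ-false k<m = refl

stateOf-∷ʳ : ∀ s k → stateOf (s ∷ʳ k) ≡ step (stateOf s) k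
stateOf-∷ʳ s k = List.foldl-∷ʳ step (rising 0) k s

top-raise : ∀ σ k → top (raise σ k) ≡ k
top-raise (rising _)     k = refl
top-raise (fallen _ _ _) k = refl

allowed-raise : ∀ σ k₀ k → allowed (raise σ k₀) k ≡ allowed σ k
allowed-raise (rising _)     k₀ k = refl
allowed-raise (fallen _ _ _) k₀ k = refl

top-step : ∀ σ k → top (step σ k) ≡ top σ ⊔ k
top-step σ k with ℕ.≤-<-connex (top σ) k
... | inj₁ m≤k rewrite step-≥ σ m≤k = trans (top-raise σ k) (sym (ℕ.m≤n⇒m⊔n≡n m≤k))
... | inj₂ k<m rewrite step-< σ k<m = sym (ℕ.m≥n⇒m⊔n≡m (ℕ.<⇒≤ k<m))

allowed-≥top : ∀ σ {k} → Valid σ → top σ ≤ k → allowed σ k ≡ true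
allowed-≥top (rising _)     _         _   = refl
allowed-≥top (fallen m M v) (_ , M≤m) m≤k rewrite ≤ᵇ-true (ℕ.≤-trans M≤m m≤k) = refl

valid-step : ∀ σ k → Valid σ → Valid (step σ k)
valid-step σ k valid with ℕ.≤-<-connex (top σ) k
valid-step (rising m)     k _           | inj₁ m≤k rewrite step-≥ (rising m) m≤k = tt
valid-step (fallen m M v) k (v<M , M≤m) | inj₁ m≤k
  rewrite step-≥ (fallen m M v) m≤k = v<M , ℕ.≤-trans M≤m m≤k
valid-step σ              k _           | inj₂ k<m rewrite step-< σ k<m = k<m , ℕ.≤-refl

newlyForbidden-≥ : ∀ {m k₀} k → m ≤ k₀ → newlyForbidden m k₀ k ≡ false
newlyForbidden-≥ {m} {k₀} k m≤k₀ with k₀ <? k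
... | yes k₀<k
  rewrite <ᵇ-true k₀<k | <ᵇ-false (ℕ.≤-trans m≤k₀ (ℕ.<⇒≤ k₀<k)) | <ᵇ-false m≤k₀ = Bool.∧-zeroʳ _
... | no k₀≮k  rewrite <ᵇ-false (ℕ.≮⇒≥ k₀≮k) | <ᵇ-false m≤k₀ = Bool.∧-zeroʳ _

allowed-step : ∀ σ k₀ → Valid σ → allowed σ k₀ ≡ true → ∀ k →
               not (allowed (step σ k₀) k) ≡ not (allowed σ k) ∨ newlyForbidden (top σ) k₀ k
allowed-step σ k₀ valid ok k with ℕ.≤-<-connex (top σ) k₀
... | inj₁ m≤k₀
  rewrite step-≥ σ m≤k₀ | allowed-raise σ k₀ k | newlyForbidden-≥ k m≤k₀ = sym (Bool.∨-identityʳ _)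
... | inj₂ k₀<m rewrite step-< σ k₀<m with ℕ.≤-<-connex (top σ) k
...   | inj₁ m≤k
  rewrite ≤ᵇ-true m≤k | allowed-≥top σ valid m≤k | <ᵇ-false m≤k
        | <ᵇ-true (ℕ.<-≤-trans k₀<m m≤k) | <ᵇ-false (ℕ.<⇒≤ (ℕ.<-≤-trans k₀<m m≤k)) = refl
...   | inj₂ k<m rewrite ≤ᵇ-false k<m | <ᵇ-true k<m | <ᵇ-true k₀<m with ℕ.<-cmp k k₀
...     | tri< k<k₀ _ _
  rewrite ≡ᵇ-false (ℕ.<⇒≢ k<k₀) | <ᵇ-false (ℕ.<⇒≤ k<k₀) | <ᵇ-true k<k₀ = sym (Bool.∨-zeroʳ _)
...     | tri≈ _ refl _ rewrite ≡ᵇ-true {k} | <ᵇ-false (ℕ.≤-refl {k}) | ok = refl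
...     | tri> _ _ k₀<k rewrite ≡ᵇ-false (ℕ.>⇒≢ k₀<k) | <ᵇ-true k₀<k = sym (Bool.∨-zeroʳ _)

record Tracks (s : List ℕ) : Set where
  field
    top-maximum     : top (stateOf s) ≡ maximum s
    forbids-allowed : ∀ k → forbids s k ≡ not (allowed (stateOf s) k)
    valid           : Valid (stateOf s)

∧-true : ∀ {x y} → x ∧ y ≡ true → x ≡ true × y ≡ true
∧-true {true} {true} _ = refl , refl

tracks-∷ʳ : ∀ s k₀ → Tracks s → allowed (stateOf s) k₀ ≡ true → Tracks (s ∷ʳ k₀)
tracks-∷ʳ s k₀ t ok = record
  { top-maximum     = begin
      top (stateOf (s ∷ʳ k₀)) ≡⟨ cong top (stateOf-∷ʳ s k₀) ⟩
      top (step σ k₀)         ≡⟨ top-step σ k₀ ⟩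
      top σ ⊔ k₀              ≡⟨ cong (_⊔ k₀) top-maximum ⟩
      maximum s ⊔ k₀          ≡⟨ sym (maximum-∷ʳ s k₀) ⟩
      maximum (s ∷ʳ k₀)       ∎
  ; forbids-allowed = λ k → begin
      forbids (s ∷ʳ k₀) k
        ≡⟨ forbids-∷ʳ s k₀ k ⟩
      forbids s k ∨ newlyForbidden (maximum s) k₀ k
        ≡⟨ cong₂ (λ x m → x ∨ newlyForbidden m k₀ k) (forbids-allowed k) (sym top-maximum) ⟩
      not (allowed σ k) ∨ newlyForbidden (top σ) k₀ k
        ≡⟨ sym (allowed-step σ k₀ valid ok k) ⟩
      not (allowed (step σ k₀) k)
        ≡⟨ cong (λ τ → not (allowed τ k)) (sym (stateOf-∷ʳ s k₀)) ⟩
      not (allowed (stateOf (s ∷ʳ k₀)) k) ∎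
  ; valid = subst Valid (sym (stateOf-∷ʳ s k₀)) (valid-step σ k₀ valid)
  }
  where
  open ≡-Reasoning
  open Tracks t
  σ = stateOf s

tracks : ∀ s → avoids s ≡ true → Tracks s
tracks s = go (reverseView s)
  where
  go : ∀ {s} → Reverse s → avoids s ≡ true → Tracks s
  go [] _ = record { top-maximum = refl ; forbids-allowed = λ _ → refl ; valid = tt }
  go (s ∶ r ∶ʳ k₀) av =
    let av-s , not-forbidden = ∧-true (trans (sym (avoids-∷ʳ s k₀)) av)
        t = go r av-s
    in tracks-∷ʳ s k₀ t (trans (sym (Bool.not-involutive _))
                               (trans (cong not (sym (Tracks.forbids-allowed t k₀))) not-forbidden))

avoids-∷ʳ-allowed : ∀ s k → avoids (s ∷ʳ k) ≡ avoids s ∧ allowed (stateOf s) k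
avoids-∷ʳ-allowed s k with avoids s in av
... | true  = trans (avoids-∷ʳ s k) (trans (cong (λ b → b ∧ not (forbids s k)) av)
                (trans (cong not (Tracks.forbids-allowed (tracks s av) k)) (Bool.not-involutive _)))
... | false = trans (avoids-∷ʳ s k) (cong (λ b → b ∧ not (forbids s k)) av)

invSeqs-induction : (P : ℕ → List ℕ → Set) → P 0 [] →
                    (∀ {n s k} → P n s → k ≤ n → P (suc n) (s ∷ʳ k)) →
                    ∀ n → All (P n) (invSeqs n)
invSeqs-induction P base extend zero    = base ∷ []
invSeqs-induction P base extend (suc n) = All.concat⁺ (All.map⁺ (All.map
  (λ Ps → All.map⁺ (All.map (λ k<1+n → extend Ps (ℕ.s≤s⁻¹ k<1+n)) (All.all-upTo (suc n))))
  (invSeqs-induction P base extend n)))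

maximum-invSeqs : ∀ n → All (λ s → maximum s ≤ ℕ.pred n) (invSeqs n)
maximum-invSeqs = invSeqs-induction _ z≤n λ {n} {s} {k} max≤ k≤n →
  subst (_≤ n) (sym (maximum-∷ʳ s k)) (ℕ.⊔-lub (ℕ.≤-trans max≤ ℕ.pred[n]≤n) k≤n)

avoiders : ℕ → List (List ℕ)
avoiders n = filterᵇ avoids (invSeqs n)

All-filterᵇ : ∀ {A : Set} {P : A → Set} (p : A → Bool) xs →
              All (λ x → p x ≡ true → P x) xs → All P (filterᵇ p xs)
All-filterᵇ p []       []         = []
All-filterᵇ p (x ∷ xs) (Px ∷ Pxs) with p x
... | true  = Px refl ∷ All-filterᵇ p xs Pxs
... | false = All-filterᵇ p xs Pxs

avoiders-valid : ∀ n → All (λ s → Valid (stateOf s) × top (stateOf s) < suc n) (avoiders (suc n))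
avoiders-valid n = All-filterᵇ avoids (invSeqs (suc n)) (All.map
  (λ {s} max≤n av → let open Tracks (tracks s av) in valid , s≤s (subst (_≤ n) (sym top-maximum) max≤n))
  (maximum-invSeqs (suc n)))

-- Formal power series over ℚ

ℚ-ring : AlmostCommutativeRing 0ℓ 0ℓ
ℚ-ring = fromCommutativeRing ℚ.+-*-commutativeRing is-zero
  where
  is-zero : ∀ x → Maybe (0ℚ ≡ x)
  is-zero x with 0ℚ ℚ.≟ x
  ... | yes p = just p
  ... | no _  = nothing

-- Equality of series is wrapped in a record so that Agda can infer f and g from f ≈ g.
infix 4 _≈_
record _≈_ (f g : PS) : Set where
  constructor coeffwise
  field coeff : f ≗ g
open _≈_ public

0P 1P : PS
0P _ = 0ℚ
1P = const 1ℚ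

-P_ : PS → PS
(-P f) n = ℚ.- f n

shift : PS → PS
shift f n = f (suc n)

scale : ℚ → PS → PS
scale c f n = c ℚ.* f n

shift-⊛ : ∀ f g → shift (f ⊛ g) ≗ scale (f 0) (shift g) ⊕ (shift f ⊛ g)
shift-⊛ f g n = cong (f 0 ℚ.* g (suc n) ℚ.+_) (cong sumℚ (trans
  (List.map-applyUpTo suc (λ k → f k ℚ.* g (suc n ∸ k)) (suc n))
  (sym (List.map-upTo (λ k → f (suc k) ℚ.* g (n ∸ k)) (suc n)))))

⊛-cong : ∀ {f f′ g g′} → f ≗ f′ → g ≗ g′ → f ⊛ g ≗ f′ ⊛ g′
⊛-cong f≗f′ g≗g′ n =
  cong sumℚ (List.map-cong (λ k → cong₂ ℚ._*_ (f≗f′ k) (g≗g′ (n ∸ k))) (upTo (suc n)))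

⊛-congˡ : ∀ {f f′} g → f ≗ f′ → f ⊛ g ≗ f′ ⊛ g
⊛-congˡ g f≗f′ = ⊛-cong {g = g} f≗f′ (λ _ → refl)

⊛-zeroˡ : ∀ g → 0P ⊛ g ≗ 0P
⊛-zeroˡ g zero    = trans (ℚ.+-identityʳ _) (ℚ.*-zeroˡ (g 0))
⊛-zeroˡ g (suc n) = trans (shift-⊛ 0P g n)
  (trans (cong₂ ℚ._+_ (ℚ.*-zeroˡ (g (suc n))) (⊛-zeroˡ g n)) (ℚ.+-identityʳ 0ℚ))

const-⊛ : ∀ c g → const c ⊛ g ≗ scale c g
const-⊛ c g zero    = ℚ.+-identityʳ _
const-⊛ c g (suc n) = trans (shift-⊛ (const c) g n)
  (trans (cong (c ℚ.* g (suc n) ℚ.+_) (⊛-zeroˡ g n)) (ℚ.+-identityʳ _))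

⊛-identityˡ : ∀ g → 1P ⊛ g ≗ g
⊛-identityˡ g n = trans (const-⊛ 1ℚ g n) (ℚ.*-identityˡ (g n))

⊛-distribʳ : ∀ f g h → (f ⊕ g) ⊛ h ≗ (f ⊛ h) ⊕ (g ⊛ h)
⊛-distribʳ f g h zero    = distrib (f 0) (g 0) (h 0) 0ℚ 0ℚ
  where
  distrib : ∀ a b c x y → (a ℚ.+ b) ℚ.* c ℚ.+ (x ℚ.+ y) ≡ (a ℚ.* c ℚ.+ x) ℚ.+ (b ℚ.* c ℚ.+ y)
  distrib = solve-∀ ℚ-ring
⊛-distribʳ f g h (suc n) = begin
  ((f ⊕ g) ⊛ h) (suc n)
    ≡⟨ shift-⊛ (f ⊕ g) h n ⟩
  (f 0 ℚ.+ g 0) ℚ.* h (suc n) ℚ.+ ((shift f ⊕ shift g) ⊛ h) n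
    ≡⟨ cong ((f 0 ℚ.+ g 0) ℚ.* h (suc n) ℚ.+_) (⊛-distribʳ (shift f) (shift g) h n) ⟩
  (f 0 ℚ.+ g 0) ℚ.* h (suc n) ℚ.+ ((shift f ⊛ h) n ℚ.+ (shift g ⊛ h) n)
    ≡⟨ distrib (f 0) (g 0) (h (suc n)) _ _ ⟩
  (f 0 ℚ.* h (suc n) ℚ.+ (shift f ⊛ h) n) ℚ.+ (g 0 ℚ.* h (suc n) ℚ.+ (shift g ⊛ h) n)
    ≡⟨ sym (cong₂ ℚ._+_ (shift-⊛ f h n) (shift-⊛ g h n)) ⟩
  ((f ⊛ h) ⊕ (g ⊛ h)) (suc n) ∎
  where
  open ≡-Reasoning
  distrib : ∀ a b c x y → (a ℚ.+ b) ℚ.* c ℚ.+ (x ℚ.+ y) ≡ (a ℚ.* c ℚ.+ x) ℚ.+ (b ℚ.* c ℚ.+ y)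
  distrib = solve-∀ ℚ-ring

scale-⊛ : ∀ c f g → scale c f ⊛ g ≗ scale c (f ⊛ g)
scale-⊛ c f g zero    = assoc c (f 0) (g 0)
  where
  assoc : ∀ c a b → c ℚ.* a ℚ.* b ℚ.+ 0ℚ ≡ c ℚ.* (a ℚ.* b ℚ.+ 0ℚ)
  assoc = solve-∀ ℚ-ring
scale-⊛ c f g (suc n) = begin
  (scale c f ⊛ g) (suc n)
    ≡⟨ shift-⊛ (scale c f) g n ⟩
  c ℚ.* f 0 ℚ.* g (suc n) ℚ.+ (scale c (shift f) ⊛ g) n
    ≡⟨ cong (c ℚ.* f 0 ℚ.* g (suc n) ℚ.+_) (scale-⊛ c (shift f) g n) ⟩
  c ℚ.* f 0 ℚ.* g (suc n) ℚ.+ c ℚ.* (shift f ⊛ g) n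
    ≡⟨ assoc c (f 0) (g (suc n)) _ ⟩
  c ℚ.* (f 0 ℚ.* g (suc n) ℚ.+ (shift f ⊛ g) n)
    ≡⟨ cong (c ℚ.*_) (sym (shift-⊛ f g n)) ⟩
  scale c (f ⊛ g) (suc n) ∎
  where
  open ≡-Reasoning
  assoc : ∀ c a b x → c ℚ.* a ℚ.* b ℚ.+ c ℚ.* x ≡ c ℚ.* (a ℚ.* b ℚ.+ x)
  assoc = solve-∀ ℚ-ring

⊛-assoc : ∀ f g h → (f ⊛ g) ⊛ h ≗ f ⊛ (g ⊛ h)
⊛-assoc f g h zero    = assoc (f 0) (g 0) (h 0)
  where
  assoc : ∀ a b c → (a ℚ.* b ℚ.+ 0ℚ) ℚ.* c ℚ.+ 0ℚ ≡ a ℚ.* (b ℚ.* c ℚ.+ 0ℚ) ℚ.+ 0ℚ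
  assoc = solve-∀ ℚ-ring
⊛-assoc f g h (suc n) = begin
  ((f ⊛ g) ⊛ h) (suc n)
    ≡⟨ shift-⊛ (f ⊛ g) h n ⟩
  (f ⊛ g) 0 ℚ.* h (suc n) ℚ.+ (shift (f ⊛ g) ⊛ h) n
    ≡⟨ cong ((f ⊛ g) 0 ℚ.* h (suc n) ℚ.+_) (⊛-congˡ h (shift-⊛ f g) n) ⟩
  (f ⊛ g) 0 ℚ.* h (suc n) ℚ.+ ((scale (f 0) (shift g) ⊕ (shift f ⊛ g)) ⊛ h) n
    ≡⟨ cong ((f ⊛ g) 0 ℚ.* h (suc n) ℚ.+_) (trans (⊛-distribʳ (scale (f 0) (shift g)) (shift f ⊛ g) h n)
         (cong₂ ℚ._+_ (scale-⊛ (f 0) (shift g) h n) (⊛-assoc (shift f) g h n))) ⟩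
  (f ⊛ g) 0 ℚ.* h (suc n) ℚ.+ (f 0 ℚ.* (shift g ⊛ h) n ℚ.+ (shift f ⊛ (g ⊛ h)) n)
    ≡⟨ assoc (f 0) (g 0) (h (suc n)) _ _ ⟩
  f 0 ℚ.* (g 0 ℚ.* h (suc n) ℚ.+ (shift g ⊛ h) n) ℚ.+ (shift f ⊛ (g ⊛ h)) n
    ≡⟨ sym (trans (shift-⊛ f (g ⊛ h) n)
                  (cong (λ x → f 0 ℚ.* x ℚ.+ (shift f ⊛ (g ⊛ h)) n) (shift-⊛ g h n))) ⟩
  (f ⊛ (g ⊛ h)) (suc n) ∎
  where
  open ≡-Reasoning
  assoc : ∀ a b c y x → (a ℚ.* b ℚ.+ 0ℚ) ℚ.* c ℚ.+ (a ℚ.* y ℚ.+ x) ≡ a ℚ.* (b ℚ.* c ℚ.+ y) ℚ.+ x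
  assoc = solve-∀ ℚ-ring

⊛-comm : ∀ f g → f ⊛ g ≗ g ⊛ f
⊛-comm f g zero          = cong (ℚ._+ 0ℚ) (ℚ.*-comm (f 0) (g 0))
⊛-comm f g (suc zero)    = comm (f 0) (f 1) (g 0) (g 1)
  where
  comm : ∀ a a′ b b′ → a ℚ.* b′ ℚ.+ (a′ ℚ.* b ℚ.+ 0ℚ) ≡ b ℚ.* a′ ℚ.+ (b′ ℚ.* a ℚ.+ 0ℚ)
  comm = solve-∀ ℚ-ring
⊛-comm f g (suc (suc m)) = begin
  (f ⊛ g) (2 ℕ.+ m)
    ≡⟨ shift-⊛ f g (suc m) ⟩
  f₀g′ ℚ.+ (shift f ⊛ g) (suc m)
    ≡⟨ cong (f₀g′ ℚ.+_) (trans (⊛-comm (shift f) g (suc m)) (shift-⊛ g (shift f) m)) ⟩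
  f₀g′ ℚ.+ (g₀f′ ℚ.+ (shift g ⊛ shift f) m)
    ≡⟨ cong (λ x → f₀g′ ℚ.+ (g₀f′ ℚ.+ x)) (⊛-comm (shift g) (shift f) m) ⟩
  f₀g′ ℚ.+ (g₀f′ ℚ.+ (shift f ⊛ shift g) m)
    ≡⟨ swap f₀g′ g₀f′ _ ⟩
  g₀f′ ℚ.+ (f₀g′ ℚ.+ (shift f ⊛ shift g) m)
    ≡⟨ cong (g₀f′ ℚ.+_) (trans (sym (shift-⊛ f (shift g) m)) (⊛-comm f (shift g) (suc m))) ⟩
  g₀f′ ℚ.+ (shift g ⊛ f) (suc m)
    ≡⟨ sym (shift-⊛ g f (suc m)) ⟩
  (g ⊛ f) (2 ℕ.+ m) ∎
  where
  open ≡-Reasoning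
  f₀g′ g₀f′ : ℚ
  f₀g′ = f 0 ℚ.* g (2 ℕ.+ m)
  g₀f′ = g 0 ℚ.* f (2 ℕ.+ m)
  swap : ∀ a b x → a ℚ.+ (b ℚ.+ x) ≡ b ℚ.+ (a ℚ.+ x)
  swap = solve-∀ ℚ-ring

PS-isCommutativeRing : IsCommutativeRing _≈_ _⊕_ _⊛_ -P_ 0P 1P
PS-isCommutativeRing = record
  { isRing = record
    { +-isAbelianGroup = record
      { isGroup = record
        { isMonoid = record
          { isSemigroup = record
            { isMagma = record
              { isEquivalence = record
                { refl  = coeffwise λ _ → refl
                ; sym   = λ f≈g → coeffwise λ n → sym (coeff f≈g n)
                ; trans = λ f≈g g≈h → coeffwise λ n → trans (coeff f≈g n) (coeff g≈h n) }
              ; ∙-cong = λ f≈f′ g≈g′ →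
                  coeffwise λ n → cong₂ ℚ._+_ (coeff f≈f′ n) (coeff g≈g′ n) }
            ; assoc = λ f g h → coeffwise λ n → ℚ.+-assoc (f n) (g n) (h n) }
          ; identity = (λ f → coeffwise λ n → ℚ.+-identityˡ (f n))
                     , (λ f → coeffwise λ n → ℚ.+-identityʳ (f n)) }
        ; inverse = (λ f → coeffwise λ n → ℚ.+-inverseˡ (f n)) , (λ f → coeffwise λ n → ℚ.+-inverseʳ (f n))
        ; ⁻¹-cong = λ f≈g → coeffwise λ n → cong ℚ.-_ (coeff f≈g n) }
      ; comm = λ f g → coeffwise λ n → ℚ.+-comm (f n) (g n) }
    ; *-cong = λ f≈f′ g≈g′ → coeffwise (⊛-cong (coeff f≈f′) (coeff g≈g′))
    ; *-assoc = λ f g h → coeffwise (⊛-assoc f g h)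
    ; *-identity = (λ f → coeffwise (⊛-identityˡ f))
                 , (λ f → coeffwise λ n → trans (⊛-comm f 1P n) (⊛-identityˡ f n))
    ; distrib = (λ f g h → coeffwise λ n → trans (⊛-comm f (g ⊕ h) n)
                  (trans (⊛-distribʳ g h f n) (cong₂ ℚ._+_ (⊛-comm g f n) (⊛-comm h f n))))
              , (λ f g h → coeffwise (⊛-distribʳ g h f)) }
  ; *-comm = λ f g → coeffwise (⊛-comm f g) }

PS-commutativeRing : CommutativeRing 0ℓ 0ℓ
PS-commutativeRing = record { isCommutativeRing = PS-isCommutativeRing }

open CommutativeRing PS-commutativeRing public
  renaming (refl to ≈-refl; sym to ≈-sym; trans to ≈-trans; reflexive to ≈-reflexive)
  using (_+_; _*_; -_; _-_; 0#; 1#; setoid; +-cong; *-cong; +-identityʳ; *-identityʳ;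
         zeroˡ; zeroʳ; distribˡ; -‿inverseʳ; -‿cong)

PS-almostCommutativeRing : ACR.AlmostCommutativeRing 0ℓ 0ℓ
PS-almostCommutativeRing = ACR.fromCommutativeRing PS-commutativeRing

const-homomorphism :
  CommutativeRing.rawRing ℚ.+-*-commutativeRing ACR.-Raw-AlmostCommutative⟶ PS-almostCommutativeRing
const-homomorphism = record
  { ⟦_⟧    = const
  ; +-homo = λ x y → coeffwise λ { zero → refl ; (suc n) → sym (ℚ.+-identityˡ 0ℚ) }
  ; *-homo = λ x y → coeffwise λ { zero → sym (ℚ.+-identityʳ (x ℚ.* y))
                                 ; (suc n) → trans (sym (ℚ.*-zeroʳ x)) (sym (const-⊛ x (const y) (suc n))) }
  ; -‿homo = λ x → coeffwise λ { zero → refl ; (suc n) → refl }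
  ; 0-homo = coeffwise λ { zero → refl ; (suc n) → refl }
  ; 1-homo = coeffwise λ { zero → refl ; (suc n) → refl } }

const-≟ : ∀ x y → Maybe (const x ≈ const y)
const-≟ x y with x ℚ.≟ y
... | yes refl = just (coeffwise λ _ → refl)
... | no _     = nothing

module PS-Solver = Algebra.Solver.Ring (CommutativeRing.rawRing ℚ.+-*-commutativeRing)
  PS-almostCommutativeRing const-homomorphism const-≟

open import Algebra.Definitions.RawSemiring (RawRing.rawSemiring (CommutativeRing.rawRing PS-commutativeRing))
  using (_^_)
module ≈-Reasoning = Relation.Binary.Reasoning.Setoid setoid

t⊛-zero : ∀ f → (tPS ⊛ f) 0 ≡ 0ℚ
t⊛-zero f = trans (ℚ.+-identityʳ _) (ℚ.*-zeroˡ (f 0))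

t⊛-suc : ∀ f n → (tPS ⊛ f) (suc n) ≡ f n
t⊛-suc f n = begin
  (tPS ⊛ f) (suc n)                      ≡⟨ shift-⊛ tPS f n ⟩
  0ℚ ℚ.* f (suc n) ℚ.+ (shift tPS ⊛ f) n  ≡⟨ cong₂ ℚ._+_ (ℚ.*-zeroˡ (f (suc n))) (⊛-congˡ f shift-t n) ⟩
  0ℚ ℚ.+ (1P ⊛ f) n                      ≡⟨ trans (ℚ.+-identityˡ _) (⊛-identityˡ f n) ⟩
  f n                                    ∎
  where
  open ≡-Reasoning
  shift-t : shift tPS ≗ 1P
  shift-t zero    = refl
  shift-t (suc _) = refl


t*f≈0⇒f≈0 : ∀ {f} → tPS * f ≈ 0P → f ≈ 0P
t*f≈0⇒f≈0 {f} tf≈0 = coeffwise λ n → trans (sym (t⊛-suc f n)) (coeff tf≈0 (suc n))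

factor-t : ∀ {f} → f 0 ≡ 0ℚ → f ≈ tPS * shift f
factor-t {f} f₀≡0 = coeffwise λ
  { zero    → trans f₀≡0 (sym (t⊛-zero (shift f)))
  ; (suc n) → sym (t⊛-suc (shift f) n) }

p*q≡0⇒q≡0 : ∀ {p q} → p ≢ 0ℚ → p ℚ.* q ≡ 0ℚ → q ≡ 0ℚ
p*q≡0⇒q≡0 {p} {q} p≢0 pq≡0 = begin
  q                      ≡⟨ sym (ℚ.*-identityˡ q) ⟩
  1ℚ ℚ.* q               ≡⟨ cong (ℚ._* q) (sym (ℚ.*-inverseˡ p)) ⟩
  ℚ.1/ p ℚ.* p ℚ.* q     ≡⟨ ℚ.*-assoc (ℚ.1/ p) p q ⟩
  ℚ.1/ p ℚ.* (p ℚ.* q)   ≡⟨ cong (ℚ.1/ p ℚ.*_) pq≡0 ⟩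
  ℚ.1/ p ℚ.* 0ℚ          ≡⟨ ℚ.*-zeroʳ (ℚ.1/ p) ⟩
  0ℚ                     ∎
  where
  open ≡-Reasoning
  instance
    p-nonZero : ℚ.NonZero p
    p-nonZero = ℚ.≢-nonZero p≢0

f*g≈0⇒g≈0 : ∀ {f g} → f 0 ≢ 0ℚ → f * g ≈ 0P → g ≈ 0P
f*g≈0⇒g≈0 {f} f₀≢0 fg≈0 = coeffwise (go fg≈0)
  where
  open CommutativeSemigroupProperties (CommutativeRing.*-commutativeSemigroup PS-commutativeRing) using (x∙yz≈y∙xz)
  go : ∀ {g} → f * g ≈ 0P → g ≗ 0P
  go {g} fg≈0 zero    = p*q≡0⇒q≡0 f₀≢0 (trans (sym (ℚ.+-identityʳ _)) (coeff fg≈0 0))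
  go {g} fg≈0 (suc n) = go (t*f≈0⇒f≈0 (begin
    tPS * (f * shift g) ≈⟨ x∙yz≈y∙xz tPS f (shift g) ⟩
    f * (tPS * shift g) ≈⟨ *-cong (≈-refl {f}) (≈-sym (factor-t (go fg≈0 zero))) ⟩
    f * g               ≈⟨ fg≈0 ⟩
    0P                  ∎)) n
    where open ≈-Reasoning

unroll-recurrence : ∀ c K (M : ℕ → PS) → (∀ n → M n ≈ const (c n) * K + tPS * M (suc n)) →
                    c * K ≈ M 0
unroll-recurrence c K M M≈ = coeffwise (go c M M≈)
  where
  go : ∀ c (M : ℕ → PS) → (∀ n → M n ≈ const (c n) * K + tPS * M (suc n)) → c ⊛ K ≗ M 0
  go c M M≈ zero    = sym (trans (coeff (M≈ 0) 0) (cong₂ ℚ._+_ (const-⊛ (c 0) K 0) (t⊛-zero (M 1))))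
  go c M M≈ (suc n) = begin
    (c ⊛ K) (suc n)
      ≡⟨ shift-⊛ c K n ⟩
    c 0 ℚ.* K (suc n) ℚ.+ (shift c ⊛ K) n
      ≡⟨ cong₂ ℚ._+_ (sym (const-⊛ (c 0) K (suc n))) (go (shift c) (M ∘ suc) (M≈ ∘ suc) n) ⟩
    (const (c 0) * K) (suc n) ℚ.+ M 1 n
      ≡⟨ cong ((const (c 0) * K) (suc n) ℚ.+_) (sym (t⊛-suc (M 1) n)) ⟩
    (const (c 0) * K + tPS * M 1) (suc n)
      ≡⟨ sym (coeff (M≈ 0) (suc n)) ⟩
    M 0 (suc n) ∎
    where open ≡-Reasoning

open Sums (CommutativeRing.semiring PS-commutativeRing)

q-suc : ∀ n → q (suc n) ≡ 1ℚ ℚ.+ q n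
q-suc n = sym (begin
  1ℚ ℚ.+ q n                     ≡⟨ cong (1ℚ ℚ.+_) (ℚ.↥p/↧p≡p n/1) ⟩
  1ℚ ℚ.+ n/1                     ≡⟨⟩
  (+ 1 ℤ.+ + n ℤ.* + 1) ℚ./ 1    ≡⟨ cong (λ z → (+ 1 ℤ.+ z) ℚ./ 1) (ℤ.*-identityʳ (+ n)) ⟩
  q (suc n)                      ∎)
  where
  open ≡-Reasoning
  n/1 : ℚ
  n/1 = ℚ.mkℚ (+ n) 0 (Coprimality.sym (Coprimality.1-coprimeTo n))

fromℕ-const : ∀ n → fromℕ n ≈ const (q n)
fromℕ-const zero    = coeffwise λ { zero → refl ; (suc _) → refl }
fromℕ-const (suc n) = coeffwise λ
  { zero    → trans (cong (1ℚ ℚ.+_) (coeff (fromℕ-const n) 0)) (sym (q-suc n))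
  ; (suc k) → trans (cong (0ℚ ℚ.+_) (coeff (fromℕ-const n) (suc k))) (ℚ.+-identityˡ 0ℚ) }

-- Sums over avoiders

children : ℕ → (List ℕ → PS) → List ℕ → PS
children n F s = ∑[ k < suc n ] (if allowed (stateOf s) k then F (s ∷ʳ k) else 0#)

∑-avoiders-suc : ∀ n F → ∑ (avoiders (suc n)) F ≈ ∑ (avoiders n) (children n F)
∑-avoiders-suc n F = begin
  ∑ (filterᵇ avoids (concatMap extensions (invSeqs n))) F
    ≈⟨ ∑-filterᵇ avoids (concatMap extensions (invSeqs n)) F ⟩
  ∑ (concatMap extensions (invSeqs n)) F-avoiding
    ≈⟨ ∑-concatMap extensions (invSeqs n) F-avoiding ⟩
  ∑[ s ∈ invSeqs n ] ∑ (extensions s) F-avoiding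
    ≈⟨ ∑-cong (All.universal (λ s → ≈-trans
         (≈-reflexive (cong (λ L → ∑ L F-avoiding) (List.map-upTo (s ∷ʳ_) (suc n))))
         (≈-trans (∑-applyUpTo (s ∷ʳ_) (suc n) F-avoiding) (extend s))) (invSeqs n)) ⟩
  ∑[ s ∈ invSeqs n ] (if avoids s then children n F s else 0#)
    ≈⟨ ≈-sym (∑-filterᵇ avoids (invSeqs n) (children n F)) ⟩
  ∑ (avoiders n) (children n F) ∎
  where
  open ≈-Reasoning
  extensions : List ℕ → List (List ℕ)
  extensions s = map (s ∷ʳ_) (upTo (suc n))
  F-avoiding : List ℕ → PS
  F-avoiding s = if avoids s then F s else 0#
  extend : ∀ s → ∑[ k < suc n ] F-avoiding (s ∷ʳ k) ≈ (if avoids s then children n F s else 0#)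
  extend s = ≈-trans
    (∑<-cong (suc n) λ k _ → ≈-reflexive (trans
      (cong (λ b → if b then F (s ∷ʳ k) else 0#) (avoids-∷ʳ-allowed s k)) (Bool.if-∧ (avoids s))))
    (∑<-if (suc n) (avoids s) (λ k → if allowed (stateOf s) k then F (s ∷ʳ k) else 0#))

-- A harmonic weight on the generating tree

module Harmonic (G : PS) (root : const (q 2) * tPS * G * G - G + 1# ≈ 0#) where

  κ : PS
  κ = 1# + G * G

  base : Bool → ℕ → PS
  base false j = G ^ suc j + G * G
  base true  j = G ^ (2 ℕ.+ j) + G * G

  β : ℕ → PS
  β j = const (q 2) * tPS * G ^ (3 ℕ.+ j)

  ψ : Bool → ℕ → ℕ → PS
  ψ f j d = base f j + fromℕ d * β j

  -- For a state of size n with j = n − maximum and depth d (see weight below): descents f d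
  -- entries below the maximum may be appended, each giving weight base true (suc j), and
  -- appending maximum + i for i ≤ j gives the summands of tail f j d.
  descents : Bool → ℕ → ℕ
  descents false d = d
  descents true  d = suc d

  tail : Bool → ℕ → ℕ → PS
  tail f j d = ∑[ i < suc j ] ψ f (suc j ∸ i) (d ℕ.+ i)

  defect : Bool → ℕ → ℕ → PS
  defect f j d = ψ f j d - (κ + tPS * (fromℕ (descents f d) * base true (suc j)))

  mod-root : ∀ {x y r} → x ≈ y + (const (q 2) * tPS * G * G - G + 1#) * r → x ≈ y
  mod-root {x} {y} {r} x≈ = begin
    x                                            ≈⟨ x≈ ⟩
    y + (const (q 2) * tPS * G * G - G + 1#) * r  ≈⟨ +-cong (≈-refl {y}) (≈-trans (*-cong root (≈-refl {r})) (zeroˡ r)) ⟩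
    y + 0#                                       ≈⟨ +-identityʳ y ⟩
    y                                            ∎
    where open ≈-Reasoning

  -- The definitions above as solver expressions, with H standing for G ^ j and D for fromℕ d;
  -- their semantics unfold definitionally to base, β, ψ and defect.
  module Syntax {n} (T G H D : PS-Solver.Polynomial n) where
    open PS-Solver using (Polynomial; _:+_; _:*_; _:-_; con)

    power : ℕ → Polynomial n
    power zero    = H
    power (suc k) = G :* power k

    number : ℕ → Polynomial n
    number zero    = D
    number (suc e) = con 1ℚ :+ number e

    κ′ : Polynomial n
    κ′ = con 1ℚ :+ G :* G

    base′ : Bool → ℕ → Polynomial n
    base′ false k = power (suc k) :+ G :* G
    base′ true  k = power (2 ℕ.+ k) :+ G :* G

    β′ : ℕ → Polynomial n
    β′ k = con (q 2) :* T :* power (3 ℕ.+ k)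

    ψ′ : Bool → ℕ → ℕ → Polynomial n
    ψ′ f k e = base′ f k :+ number e :* β′ k

    defect′ : Bool → ℕ → ℕ → Polynomial n
    defect′ f k e = ψ′ f k e :- (κ′ :+ T :* (number (descents f e) :* base′ true (suc k)))

    root′ : Polynomial n
    root′ = con (q 2) :* T :* G :* G :- G :+ con 1ℚ

  open PS-Solver using (solve; _:=_; _:+_; _:*_; _:-_; :-_; con)

  -- In each identity the factor of root′ is the quotient by the root equation.
  defect-zero : ∀ f d → defect f 0 d ≈ tPS * ψ f 1 d
  defect-zero false d = mod-root (solve 3 (λ T G D → let open Syntax T G (con 1ℚ) D in
    defect′ false 0 0 := T :* ψ′ false 1 0 :+ root′ :* (:- (con 1ℚ :+ T :* G :* G :* D)))
    (coeffwise λ _ → refl) tPS G (fromℕ d))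
  defect-zero true  d = mod-root (solve 3 (λ T G D → let open Syntax T G (con 1ℚ) D in
    defect′ true 0 0 := T :* ψ′ true 1 0 :+ root′ :* (:- (con 1ℚ :+ G :+ T :* G :* G :* D)))
    (coeffwise λ _ → refl) tPS G (fromℕ d))

  defect-suc : ∀ f j d → defect f (suc j) d ≈ tPS * ψ f (2 ℕ.+ j) d + defect f j (suc d)
  defect-suc false j d = mod-root (solve 4 (λ T G H D → let open Syntax T G H D in
    defect′ false 1 0 := T :* ψ′ false 2 0 :+ defect′ false 0 1
                         :+ root′ :* (:- (G :* H :+ T :* G :* power 2 :* D)))
    (coeffwise λ _ → refl) tPS G (G ^ j) (fromℕ d))
  defect-suc true  j d = mod-root (solve 4 (λ T G H D → let open Syntax T G H D in
    defect′ true 1 0 := T :* ψ′ true 2 0 :+ defect′ true 0 1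
                        :+ root′ :* (:- (power 2 :+ T :* G :* power 2 :* D)))
    (coeffwise λ _ → refl) tPS G (G ^ j) (fromℕ d))

  tail-suc : ∀ f j d → tail f (suc j) d ≈ ψ f (2 ℕ.+ j) d + tail f j (suc d)
  tail-suc f j d = +-cong (≈-reflexive (cong (ψ f (2 ℕ.+ j)) (ℕ.+-identityʳ d)))
    (∑<-cong (suc j) λ i _ → ≈-reflexive (cong (ψ f (suc j ∸ i)) (ℕ.+-suc d i)))

  t*tail : ∀ f j d → tPS * tail f j d ≈ defect f j d
  t*tail f zero    d = begin
    tPS * (ψ f 1 (d ℕ.+ 0) + 0#)
      ≈⟨ *-cong (≈-refl {tPS}) (≈-trans (+-identityʳ _) (≈-reflexive (cong (ψ f 1) (ℕ.+-identityʳ d)))) ⟩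
    tPS * ψ f 1 d
      ≈⟨ ≈-sym (defect-zero f d) ⟩
    defect f 0 d ∎
    where open ≈-Reasoning
  t*tail f (suc j) d = begin
    tPS * tail f (suc j) d                           ≈⟨ *-cong (≈-refl {tPS}) (tail-suc f j d) ⟩
    tPS * (ψ f (2 ℕ.+ j) d + tail f j (suc d))       ≈⟨ distribˡ tPS (ψ f (2 ℕ.+ j) d) (tail f j (suc d)) ⟩
    tPS * ψ f (2 ℕ.+ j) d + tPS * tail f j (suc d)   ≈⟨ +-cong (≈-refl {tPS * ψ f (2 ℕ.+ j) d})
                                                                (t*tail f j (suc d)) ⟩
    tPS * ψ f (2 ℕ.+ j) d + defect f j (suc d)       ≈⟨ ≈-sym (defect-suc f j d) ⟩
    defect f (suc j) d                               ∎
    where open ≈-Reasoning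

  harmonic : ∀ f j d → ψ f j d ≈ κ + tPS * (fromℕ (descents f d) * base true (suc j) + tail f j d)
  harmonic f j d = begin
    ψ f j d
      ≈⟨ solve 2 (λ x y → x := y :+ (x :- y)) (coeffwise λ _ → refl) (ψ f j d) rest ⟩
    rest + defect f j d
      ≈⟨ +-cong (≈-refl {rest}) (≈-sym (t*tail f j d)) ⟩
    rest + tPS * tail f j d
      ≈⟨ solve 4 (λ k t x y → k :+ t :* x :+ t :* y := k :+ t :* (x :+ y)) (coeffwise λ _ → refl)
                 κ tPS (fromℕ (descents f d) * base true (suc j)) (tail f j d) ⟩
    κ + tPS * (fromℕ (descents f d) * base true (suc j) + tail f j d) ∎
    where
    open ≈-Reasoning
    rest = κ + tPS * (fromℕ (descents f d) * base true (suc j))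

  ψ-zero : ∀ f j → ψ f j 0 ≈ base f j
  ψ-zero f j = ≈-trans (+-cong (≈-refl {base f j}) (zeroˡ (β j))) (+-identityʳ (base f j))

module Weights (G : PS) (root : const (q 2) * tPS * G * G - G + 1# ≈ 0#) where

  open Harmonic G root public

  hasFallen : State → Bool
  hasFallen (rising _)     = false
  hasFallen (fallen _ _ _) = true

  depth : State → ℕ
  depth (rising m)     = m
  depth (fallen m M _) = m ∸ M

  weight : ℕ → State → PS
  weight n σ = ψ (hasFallen σ) (n ∸ top σ) (depth σ)

  if-then-cong : ∀ b {x y} → x ≈ y → (if b then x else 0#) ≈ (if b then y else 0#)
  if-then-cong true  x≈y = x≈y
  if-then-cong false _   = ≈-refl

  weight-descent : ∀ {n} σ {k} → top σ ≤ n → k < top σ →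
                   weight (suc n) (step σ k) ≈ base true (suc (n ∸ top σ))
  weight-descent {n} σ m≤n k<m rewrite step-< σ k<m = ≈-trans
    (≈-reflexive (cong₂ (ψ true) (ℕ.+-∸-assoc 1 m≤n) (ℕ.n∸n≡0 (top σ))))
    (ψ-zero true (suc (n ∸ top σ)))

  descent-sum : ∀ σ r → Valid σ →
                ∑[ k < top σ ] (if allowed σ k then r else 0#) ≈ fromℕ (descents (hasFallen σ) (depth σ)) * r
  descent-sum (rising m)     r _           = ∑<-const m r
  descent-sum (fallen m M v) r (v<M , M≤m) = begin
    ∑[ k < m ] h k                                 ≡⟨ cong (λ l → ∑< l h) (sym (ℕ.m+[n∸m]≡n M≤m)) ⟩
    ∑[ k < M ℕ.+ (m ∸ M) ] h k                     ≈⟨ ∑<-split M (m ∸ M) h ⟩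
    ∑[ k < M ] h k + ∑[ i < m ∸ M ] h (M ℕ.+ i)   ≈⟨ +-cong
                                                       (≈-trans (∑<-cong M below) (∑<-indicator r v<M))
                                                       (≈-trans (∑<-cong (m ∸ M) above) (∑<-const (m ∸ M) r)) ⟩
    r + fromℕ (m ∸ M) * r                          ≈⟨ fromℕ-suc-* (m ∸ M) r ⟩
    fromℕ (suc (m ∸ M)) * r                        ∎
    where
    open ≈-Reasoning
    h : ℕ → PS
    h k = if allowed (fallen m M v) k then r else 0#
    below : ∀ k → k < M → h k ≈ (if k ≡ᵇ v then r else 0#)
    below k k<M rewrite ≤ᵇ-false k<M = ≈-refl
    above : ∀ i → i < m ∸ M → h (M ℕ.+ i) ≈ r
    above i _ rewrite ≤ᵇ-true (ℕ.m≤m+n M i) = ≈-refl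

  depth-raise : ∀ σ i → Valid σ → depth (raise σ (top σ ℕ.+ i)) ≡ depth σ ℕ.+ i
  depth-raise (rising m)     i _         = refl
  depth-raise (fallen m M v) i (_ , M≤m) = ℕ.+-∸-comm i M≤m

  hasFallen-raise : ∀ σ k → hasFallen (raise σ k) ≡ hasFallen σ
  hasFallen-raise (rising _)     k = refl
  hasFallen-raise (fallen _ _ _) k = refl

  weight-ascent : ∀ {n} σ i → Valid σ → top σ ≤ n →
                  (if allowed σ (top σ ℕ.+ i) then weight (suc n) (step σ (top σ ℕ.+ i)) else 0#)
                    ≈ ψ (hasFallen σ) (suc (n ∸ top σ) ∸ i) (depth σ ℕ.+ i)
  weight-ascent {n} σ i valid m≤n
    rewrite allowed-≥top σ valid (ℕ.m≤m+n (top σ) i) | step-≥ σ (ℕ.m≤m+n (top σ) i)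
          | hasFallen-raise σ (top σ ℕ.+ i) | top-raise σ (top σ ℕ.+ i) | depth-raise σ i valid
          | sym (ℕ.∸-+-assoc (suc n) (top σ) i) | ℕ.+-∸-assoc 1 m≤n = ≈-refl

  weight-harmonic : ∀ n σ → Valid σ → top σ < n →
                    weight n σ ≈ κ + tPS * ∑[ k < suc n ] (if allowed σ k then weight (suc n) (step σ k) else 0#)
  weight-harmonic n σ valid m<n = begin
    ψ f j d                                                           ≈⟨ harmonic f j d ⟩
    κ + tPS * (fromℕ (descents f d) * base true (suc j) + tail f j d)  ≈⟨ +-cong (≈-refl {κ})
                                                                           (*-cong (≈-refl {tPS}) (≈-sym split)) ⟩
    κ + tPS * ∑< (suc n) h                                            ∎
    where
    open ≈-Reasoning
    m = top σ
    j = n ∸ m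
    f = hasFallen σ
    d = depth σ
    m≤n = ℕ.<⇒≤ m<n
    h : ℕ → PS
    h k = if allowed σ k then weight (suc n) (step σ k) else 0#
    split : ∑< (suc n) h ≈ fromℕ (descents f d) * base true (suc j) + tail f j d
    split = begin
      ∑< (suc n) h
        ≡⟨ cong (λ l → ∑< l h) (trans (cong suc (sym (ℕ.m+[n∸m]≡n m≤n))) (sym (ℕ.+-suc m j))) ⟩
      ∑< (m ℕ.+ suc j) h
        ≈⟨ ∑<-split m (suc j) h ⟩
      ∑< m h + ∑[ i < suc j ] h (m ℕ.+ i)
        ≈⟨ +-cong (≈-trans (∑<-cong m λ k k<m → if-then-cong (allowed σ k) (weight-descent σ m≤n k<m))
                           (descent-sum σ (base true (suc j)) valid))
                  (∑<-cong (suc j) λ i _ → weight-ascent σ i valid m≤n) ⟩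
      fromℕ (descents f d) * base true (suc j) + tail f j d ∎

  totalWeight : ℕ → PS
  totalWeight n = ∑[ s ∈ avoiders n ] weight n (stateOf s)

  totalWeight-recurrence : ∀ n →
                           totalWeight (suc n) ≈ fromℕ (a (suc n)) * κ + tPS * totalWeight (suc (suc n))
  totalWeight-recurrence n = begin
    totalWeight (suc n)
      ≈⟨ ∑-cong (All.map (λ {s} (valid , m<n) → weight-harmonic (suc n) (stateOf s) valid m<n)
                         (avoiders-valid n)) ⟩
    ∑[ s ∈ L ] (κ + tPS * C s)
      ≈⟨ ∑-+ L (λ _ → κ) (λ s → tPS * C s) ⟩
    ∑[ s ∈ L ] κ + ∑[ s ∈ L ] (tPS * C s)
      ≈⟨ +-cong (∑-const L κ) (∑-*ˡ L tPS C) ⟩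
    fromℕ (a (suc n)) * κ + tPS * ∑ L C
      ≈⟨ +-cong (≈-refl {fromℕ (a (suc n)) * κ}) (*-cong (≈-refl {tPS}) (≈-trans
           (∑-cong (All.universal (λ s → ∑<-cong (suc (suc n)) λ k _ → if-then-cong (allowed (stateOf s) k)
              (≈-reflexive (cong (weight (suc (suc n))) (sym (stateOf-∷ʳ s k))))) L))
           (≈-sym (∑-avoiders-suc (suc n) (weight (suc (suc n)) ∘ stateOf))))) ⟩
    fromℕ (a (suc n)) * κ + tPS * totalWeight (suc (suc n)) ∎
    where
    open ≈-Reasoning
    L = avoiders (suc n)
    C : List ℕ → PS
    C s = ∑[ k < suc (suc n) ]
            (if allowed (stateOf s) k then weight (suc (suc n)) (step (stateOf s) k) else 0#)

-- The generating function

module ClosedForm (S : PS) (S₀ : S 0 ≡ q 1) (S² : S * S ≈ const (q 1) - const (q 8) * tPS) where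

  open PS-Solver using (solve; _:=_; _:+_; _:*_; _:-_; :-_; con)

  -- G = (1 − S) / 4t.
  G : PS
  G = scale (ℚ.- (+ 1 ℚ./ 4)) (shift S)

  S-via-G : S ≈ 1# - const (q 4) * (tPS * G)
  S-via-G = coeffwise λ
    { zero    → trans S₀ (cong (λ x → 1ℚ ℚ.- (q 4 ℚ.* x ℚ.+ 0ℚ)) (sym (t⊛-zero G)))
    ; (suc n) → trans (undo-scale (S (suc n))) (cong (λ x → 0ℚ ℚ.- x)
                  (sym (trans (const-⊛ (q 4) (tPS * G) (suc n)) (cong (q 4 ℚ.*_) (t⊛-suc G n))))) }
    where
    undo-scale : ∀ x → x ≡ 0ℚ ℚ.- q 4 ℚ.* (ℚ.- (+ 1 ℚ./ 4) ℚ.* x)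
    undo-scale = solve-∀ ℚ-ring

  root : const (q 2) * tPS * G * G - G + 1# ≈ 0#
  root = f*g≈0⇒g≈0 {const (q 8)} (λ ()) (t*f≈0⇒f≈0 (begin
    tPS * (const (q 8) * E)
      ≈⟨ solve 2 (λ T G → T :* (con (q 8) :* (con (q 2) :* T :* G :* G :- G :+ con 1ℚ))
                      := (con 1ℚ :- con (q 4) :* (T :* G)) :* (con 1ℚ :- con (q 4) :* (T :* G))
                         :- (con (q 1) :- con (q 8) :* T))
                 (coeffwise λ _ → refl) tPS G ⟩
    (1# - const (q 4) * (tPS * G)) * (1# - const (q 4) * (tPS * G)) - (const (q 1) - const (q 8) * tPS)
      ≈⟨ +-cong (≈-trans (*-cong (≈-sym S-via-G) (≈-sym S-via-G)) S²)
                (≈-refl { - (const (q 1) - const (q 8) * tPS)}) ⟩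
    (const (q 1) - const (q 8) * tPS) - (const (q 1) - const (q 8) * tPS)
      ≈⟨ -‿inverseʳ (const (q 1) - const (q 8) * tPS) ⟩
    0# ∎))
    where
    open ≈-Reasoning
    E = const (q 2) * tPS * G * G - G + 1#

  G₀ : G 0 ≡ 1ℚ
  G₀ = trans (solve-for-G₀ (G 0)) (cong (λ e → 1ℚ ℚ.- e) (coeff root 0))
    where
    -- The constant term of the root equation, with (f * g) 0 = f 0 * g 0 + 0 unfolded.
    solve-for-G₀ : ∀ g → g ≡ 1ℚ ℚ.- ((((q 2 ℚ.* 0ℚ ℚ.+ 0ℚ) ℚ.* g ℚ.+ 0ℚ) ℚ.* g ℚ.+ 0ℚ) ℚ.- g ℚ.+ 1ℚ)
    solve-for-G₀ = solve-∀ ℚ-ring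

  open Weights G root

  κ₀ : κ 0 ≡ 1ℚ ℚ.+ 1ℚ
  κ₀ = cong (λ g → 1ℚ ℚ.+ (g ℚ.* g ℚ.+ 0ℚ)) G₀

  κ₀≢0 : κ 0 ≢ 0ℚ
  κ₀≢0 κ₀≡0 = 2≢0 (trans (sym κ₀) κ₀≡0)
    where
    2≢0 : 1ℚ ℚ.+ 1ℚ ≢ 0ℚ
    2≢0 ()

  totalWeight-1 : totalWeight 1 ≈ const (q 2) * G * G
  totalWeight-1 = ≈-trans (+-identityʳ (ψ false 1 0)) (≈-trans (ψ-zero false 1)
         (solve 1 (λ G → G :* (G :* con 1ℚ) :+ G :* G := con (q 2) :* G :* G) (coeffwise λ _ → refl) G))

  shiftA*κ : shift A * κ ≈ const (q 2) * G * G
  shiftA*κ = ≈-trans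
    (unroll-recurrence (shift A) κ (totalWeight ∘ suc) λ n → ≈-trans (totalWeight-recurrence n)
      (+-cong (*-cong (fromℕ-const (a (suc n))) (≈-refl {κ})) (≈-refl {tPS * totalWeight (2 ℕ.+ n)})))
    totalWeight-1

  A-via-shift : A ≈ 1# + tPS * shift A
  A-via-shift = coeffwise λ
    { zero    → sym (cong (1ℚ ℚ.+_) (t⊛-zero (shift A)))
    ; (suc n) → sym (trans (cong (0ℚ ℚ.+_) (t⊛-suc (shift A) n)) (ℚ.+-identityˡ (shift A n))) }

  denominator numerator : PS
  denominator = const (q 4) * (tPS * tPS) - const (q 4) * tPS + const (q 2)
  numerator   = const (q 2) - tPS - tPS * S

  denominator*A : denominator * A ≈ numerator
  denominator*A = x∙y⁻¹≈ε⇒x≈y (denominator * A) numerator (f*g≈0⇒g≈0 {κ} κ₀≢0 (begin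
    κ * (denominator * A - numerator)
      ≈⟨ *-cong (≈-refl {κ}) (+-cong (*-cong (≈-refl {denominator}) A-via-shift)
           (-‿cong (+-cong (≈-refl {const (q 2) - tPS}) (-‿cong (*-cong (≈-refl {tPS}) S-via-G))))) ⟩
    κ * (denominator * (1# + tPS * shift A) - (const (q 2) - tPS - tPS * (1# - const (q 4) * (tPS * G))))
      ≈⟨ mod-root (solve 3 (λ T G X →
           let κ′ = con 1ℚ :+ G :* G
               d′ = con (q 4) :* (T :* T) :- con (q 4) :* T :+ con (q 2)
           in κ′ :* (d′ :* (con 1ℚ :+ T :* X) :- (con (q 2) :- T :- T :* (con 1ℚ :- con (q 4) :* (T :* G))))
              := d′ :* T :* (X :* κ′ :- con (q 2) :* G :* G)
                 :+ (con (q 2) :* T :* G :* G :- G :+ con 1ℚ)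
                    :* (con (q 4) :* T :* T :- con (q 2) :* T :- con (q 2) :* T :* G))
           (coeffwise λ _ → refl) tPS G (shift A)) ⟩
    denominator * tPS * (shift A * κ - const (q 2) * G * G)
      ≈⟨ *-cong (≈-refl {denominator * tPS}) (x≈y⇒x∙y⁻¹≈ε shiftA*κ) ⟩
    denominator * tPS * 0#
      ≈⟨ zeroʳ (denominator * tPS) ⟩
    0# ∎))
    where
    open ≈-Reasoning
    open GroupProperties (CommutativeRing.+-group PS-commutativeRing)
      using (x∙y⁻¹≈ε⇒x≈y; x≈y⇒x∙y⁻¹≈ε)

theorem3p3 : (S D : PS) →
    S 0 ≡ q 1 →
    (∀ n → (S ⊛ S) n ≡ (const (q 1) ⊖ (const (q 8) ⊛ tPS)) n) →
    (∀ n → ((((const (q 4) ⊛ (tPS ⊛ tPS)) ⊖ (const (q 4) ⊛ tPS)) ⊕ const (q 2)) ⊛ D) n ≡ const (q 1) n) →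
    ∀ n → A n ≡ (((const (q 2) ⊖ tPS) ⊖ (tPS ⊛ S)) ⊛ D) n
theorem3p3 S D S₀ S² denominator*D≡1 = coeff (begin
  A                      ≈⟨ ≈-sym (*-identityʳ A) ⟩
  A * 1#                 ≈⟨ *-cong (≈-refl {A}) (≈-sym (coeffwise denominator*D≡1)) ⟩
  A * (denominator * D)  ≈⟨ x∙yz≈yx∙z A denominator D ⟩
  denominator * A * D    ≈⟨ *-cong denominator*A (≈-refl {D}) ⟩
  numerator * D          ∎)
  where
  open ClosedForm S S₀ (coeffwise S²)
  open ≈-Reasoning
  open CommutativeSemigroupProperties (CommutativeRing.*-commutativeSemigroup PS-commutativeRing)
    using (x∙yz≈yx∙z)
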